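{- For every finite or infinite word $\mathbf t$, $O(\mathbf t)\le D(\mathbf t)$, where $O(\mathbf t)$ is the number of oddities of $\mathbf t$ and $D(\mathbf t)$ its defect.
   Context: For a finite word $w$, $D(w)=|w|+1-|\mathrm{PAL}(w)|$, where $\mathrm{PAL}(w)$ is the set of distinct palindromic factors of $w$ (including the empty word); for an infinite word, $D$ is the supremum of the defects of its factors (possibly infinite). A complete return to a factor $u$ is a factor containing exactly two occurrences of $u$, one as prefix and one as suffix. An oddity of $\mathbf t$ is an unordered pair $\{w,\tilde w\}$ ($\tilde w$ the reversal of $w$) such that $w$ or $\tilde w$ is a non-palindromic complete return in $\mathbf t$ to some non-empty palindromic factor of $\mathbf t$. -}

module Defs where

open import Data.Nat using (ℕ; zero; suc; _+_; _∸_; _≤_)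
open import Data.List using (List; []; _∷_; _++_; length; reverse; tails; inits; concatMap; filter; deduplicate; map; upTo)
open import Data.List.Properties using (≡-dec)
open import Data.List.Relation.Unary.All using (All)
open import Data.List.Relation.Unary.AllPairs using (AllPairs)
open import Data.Product using (Σ; ∃; ∃-syntax; _×_; _,_)
open import Data.Sum using (_⊎_)
open import Relation.Nullary using (¬_)
open import Relation.Binary.PropositionalEquality using (_≡_; _≢_)
open import Relation.Binary.Definitions using (DecidableEquality)

module Words {A : Set} (_≟_ : DecidableEquality A) where

  Word : Set
  Word = List A

  _≟w_ : DecidableEquality Word
  _≟w_ = ≡-dec _≟_

  IsPal : Word → Set
  IsPal w = reverse w ≡ w

  allFactors : Word → List Word
  allFactors w = concatMap inits (tails w)

  -- PAL(w): the distinct palindromic factors of w (including the empty word)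
  PAL : Word → List Word
  PAL w = deduplicate _≟w_ (filter (λ u → reverse u ≟w u) (allFactors w))

  defect : Word → ℕ
  defect w = suc (length w) ∸ length (PAL w)

  FactorF : Word → Word → Set
  FactorF t u = ∃[ p ] ∃[ s ] p ++ u ++ s ≡ t

  segment : (ℕ → A) → ℕ → ℕ → Word
  segment x i n = map (λ k → x (i + k)) (upTo n)

  FactorI : (ℕ → A) → Word → Set
  FactorI x u = ∃[ i ] u ≡ segment x i (length u)

  OccursAt : Word → Word → ℕ → Set
  OccursAt u w i = ∃[ p ] ∃[ s ] length p ≡ i × p ++ u ++ s ≡ w

  IsCompleteReturn : Word → Word → Set
  IsCompleteReturn u w =
    (∃[ s ] u ++ s ≡ w) × (∃[ p ] p ++ u ≡ w) ×
    (∃[ i ] ∃[ j ] i ≢ j × OccursAt u w i × OccursAt u w j ×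
       (∀ k → OccursAt u w k → k ≡ i ⊎ k ≡ j))

  -- given the factor predicate F of a word t: w is a non-palindromic complete
  -- return in t to some non-empty palindromic factor of t
  NonPalCR : (Word → Set) → Word → Set
  NonPalCR F w = F w × ¬ IsPal w ×
    (∃[ u ] u ≢ [] × IsPal u × F u × IsCompleteReturn u w)

  -- w represents an oddity {w, w̃} of t
  OddityRep : (Word → Set) → Word → Set
  OddityRep F w = NonPalCR F w ⊎ NonPalCR F (reverse w)

  -- two representatives denote different unordered pairs {w,w̃}
  DistinctOddities : Word → Word → Set
  DistinctOddities w v = w ≢ v × w ≢ reverse v

  OddityList : (Word → Set) → List Word → Set
  OddityList F ws = All (OddityRep F) ws × AllPairs DistinctOddities ws

module Submission where

-- For a finite word t, D(t) = |t| + 1 − |PAL(t)|, so it suffices to give the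
-- palindromic factors and the oddities pairwise distinct positions in 0 … |t|.
-- A palindrome gets the end of its first occurrence; an oddity {w, w̃} gets the
-- earliest end of an occurrence of w or w̃, where the occurring word X is a
-- non-palindromic complete return to a palindrome u.  At that position every
-- palindromic suffix of the prefix read so far is a proper prefix of X, hence
-- occurred before (so no palindrome shares the position), u is the longest
-- such suffix, and complete returns to u ending at one position coincide (so no
-- other oddity shares it).  Two palindromes first ending at one position are
-- equal.  Pigeonhole then gives the bound.  For an infinite word, the finitely
-- many witnesses of the oddities lie in one prefix, whose defect is the bound.

open import Defs
open import Data.Nat using (ℕ; _≤_)
open import Data.List using (List; length)
open import Data.Product using (_×_; ∃-syntax)
open import Relation.Binary.Definitions using (DecidableEquality)

open import Data.Nat using (zero; suc; _+_; _∸_; _⊓_; _<_; z≤n; s≤s; _≤?_)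
open import Data.Nat.Properties
  using ( ≤-refl; ≤-reflexive; ≤-trans; <⇒≤; <⇒≱; ≰⇒>; ≮⇒≥; <-irrefl; ≤-total
        ; +-assoc; +-comm; +-identityʳ; +-cancelˡ-≡; +-cancelʳ-≡; +-cancelʳ-≤; +-monoʳ-≤
        ; m≤m+n; m<m+n; m<n+m; n≤0⇒n≡0; n≢0⇒n>0; m+n≤o⇒m≤o; m+n≤o⇒n≤o; m+n≤o⇒m≤o∸n; m+[n∸m]≡n; m≢1+n+m; m⊓n≤m; anyUpTo?; module ≤-Reasoning )
open import Data.Nat.Induction using (<-rec)
open import Data.Fin using (Fin; zero; suc; fromℕ<)
open import Data.Fin.Properties using (pigeonhole; fromℕ<-injective)
open import Data.List using ([]; _∷_; _++_; reverse; take; drop; filter; upTo; applyUpTo; inits; tails; lookup)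
open import Data.List.Properties
  using ( ∷-injective; length-++; ++-assoc; ++-identityʳ; ++-conicalʳ; length-take; take++drop≡id
        ; reverse-++; reverse-involutive; length-reverse; length-map; length-upTo; map-upTo )
open import Data.List.Relation.Unary.All using (All; []; _∷_)
import Data.List.Relation.Unary.All as All
import Data.List.Relation.Unary.All.Properties as AllProp
open import Data.List.Relation.Unary.Any using (here; there; any?)
open import Data.List.Relation.Unary.AllPairs using (AllPairs; []; _∷_)
import Data.List.Relation.Unary.AllPairs.Properties as AllPairsProp
open import Data.List.Membership.Propositional using (_∈_; find; lose)
open import Data.List.Membership.Propositional.Properties
  using (∈-lookup; ∈-map⁻; ∈-concatMap⁻; ∈-filter⁻; ∈-deduplicate⁻)
open import Data.List.Relation.Unary.Unique.DecPropositional.Properties using (deduplicate-!)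
open import Data.Product using (_,_; proj₁; proj₂)
open import Data.Sum using (_⊎_; inj₁; inj₂; map₂)
open import Relation.Nullary using (¬_; Dec; yes; no; contradiction)
open import Relation.Binary.PropositionalEquality
  using (_≡_; _≢_; refl; sym; trans; cong; cong₂; subst; module ≡-Reasoning)

module _ {A : Set} where

  ++-split : (a x b y : List A) → a ++ x ≡ b ++ y → length b ≤ length a →
             ∃[ c ] a ≡ b ++ c × y ≡ c ++ x
  ++-split a x [] y eq _ = a , refl , sym eq
  ++-split (z ∷ a) x (z′ ∷ b) y eq (s≤s b≤a) with ∷-injective eq
  ... | refl , eq′ with ++-split a x b y eq′ b≤a
  ...   | c , a≡bc , y≡cx = c , cong (z ∷_) a≡bc , y≡cx

  ++-suffix : (c p d q : List A) → c ++ p ≡ d ++ q → length q ≤ length p →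
              ∃[ f ] p ≡ f ++ q
  ++-suffix c p d q eq q≤p = proj₁ split , proj₂ (proj₂ split)
    where
    lengths : length c + length p ≡ length d + length q
    lengths = trans (sym (length-++ c)) (trans (cong length eq) (length-++ d))
    c≤d : length c ≤ length d
    c≤d = +-cancelʳ-≤ (length q) (length c) (length d)
            (≤-trans (+-monoʳ-≤ (length c) q≤p) (≤-reflexive lengths))
    split : ∃[ f ] d ≡ c ++ f × p ≡ f ++ q
    split = ++-split d q c p (sym eq) c≤d

  ++-suffix-≡ : (c p d q : List A) → c ++ p ≡ d ++ q → length p ≡ length q → p ≡ q
  ++-suffix-≡ c p d q eq same with ++-suffix c p d q eq (≤-reflexive (sym same))
  ... | [] , p≡q = p≡q
  ... | x ∷ f , p≡xfq = contradiction
          (trans (sym same) (trans (cong length p≡xfq) (cong suc (length-++ f))))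
          (m≢1+n+m (length q))

  prefix-until : (a y b t : List A) → a ++ y ++ b ≡ t → take (length a + length y) t ≡ a ++ y
  prefix-until a y b t occ = begin
      take (length a + length y) t                ≡⟨ cong₂ take (sym (length-++ a))
                                                                (trans (sym occ) (sym (++-assoc a y b))) ⟩
      take (length (a ++ y)) ((a ++ y) ++ b)      ≡⟨ take-length (a ++ y) b ⟩
      a ++ y                                      ∎
    where
    open ≡-Reasoning
    take-length : (xs ys : List A) → take (length xs) (xs ++ ys) ≡ xs
    take-length []       ys = refl
    take-length (x ∷ xs) ys = cong (x ∷_) (take-length xs ys)

  length-occurrence : (a y b t : List A) → a ++ y ++ b ≡ t → length a + (length y + length b) ≡ length t
  length-occurrence a y b t occ = begin
      length a + (length y + length b)  ≡⟨ cong (length a +_) (sym (length-++ y)) ⟩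
      length a + length (y ++ b)        ≡⟨ sym (length-++ a) ⟩
      length (a ++ y ++ b)              ≡⟨ cong length occ ⟩
      length t                          ∎
    where open ≡-Reasoning

  occurrence-fits : (a y b t : List A) → a ++ y ++ b ≡ t → length a + length y ≤ length t
  occurrence-fits a y b t occ = begin
      length a + length y                 ≤⟨ m≤m+n (length a + length y) (length b) ⟩
      length a + length y + length b      ≡⟨ +-assoc (length a) (length y) (length b) ⟩
      length a + (length y + length b)    ≡⟨ length-occurrence a y b t occ ⟩
      length t                            ∎
    where open ≤-Reasoning

  applyUpTo-++ : (f : ℕ → A) (m n : ℕ) →
                 applyUpTo f (m + n) ≡ applyUpTo f m ++ applyUpTo (λ k → f (m + k)) n
  applyUpTo-++ f zero    n = refl
  applyUpTo-++ f (suc m) n = cong (f 0 ∷_) (applyUpTo-++ (λ k → f (suc k)) m n)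

  palindrome-suffix : (p f y : List A) → reverse p ≡ p → p ≡ f ++ y → p ≡ reverse y ++ reverse f
  palindrome-suffix p f y pal p≡fy = trans (sym pal) (trans (cong reverse p≡fy) (reverse-++ f y))

LeastWitnessUpTo : (ℕ → Set) → ℕ → Set
LeastWitnessUpTo P n = ∃[ m ] P m × m ≤ n × (∀ k → P k → m ≤ k)

least-witness : {P : ℕ → Set} → (∀ n → Dec (P n)) → ∀ n → P n → LeastWitnessUpTo P n
least-witness {P} P? = <-rec (λ n → P n → LeastWitnessUpTo P n) step
  where
  step : ∀ n → (∀ {m} → m < n → P m → LeastWitnessUpTo P m) → P n → LeastWitnessUpTo P n
  step n smaller Pn with anyUpTo? P? n
  ... | no none = n , Pn , ≤-refl , λ k Pk → ≮⇒≥ (λ k<n → none (k , k<n , Pk))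
  ... | yes (m , m<n , Pm) with smaller m<n Pm
  ...   | l , Pl , l≤m , isLeast = l , Pl , ≤-trans l≤m (<⇒≤ m<n) , isLeast

allPairs-lookup : {B : Set} {R : B → B → Set} {xs : List B} → AllPairs R xs →
                  {i j : Fin (length xs)} → i Data.Fin.< j → R (lookup xs i) (lookup xs j)
allPairs-lookup (Rx ∷ _)   {zero}  {suc j} _         = All.lookup Rx (∈-lookup j)
allPairs-lookup (_ ∷ Rxs)  {suc i} {suc j} (s≤s i<j) = allPairs-lookup Rxs i<j

distinct-below : ∀ m (ns : List ℕ) → AllPairs _≢_ ns → All (_< m) ns → length ns ≤ m
distinct-below m ns distinct below with length ns ≤? m
... | yes fits = fits
... | no overflow with pigeonhole (≰⇒> overflow) (λ i → fromℕ< (All.lookup below (∈-lookup i)))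
...   | i , j , i<j , same = contradiction (fromℕ<-injective _ _ _ _ same) (allPairs-lookup distinct i<j)

two-point : {B : Set} {x y i j k : B} → x ≢ y → x ≡ i ⊎ x ≡ j → y ≡ i ⊎ y ≡ j → k ≡ i ⊎ k ≡ j →
            k ≡ x ⊎ k ≡ y
two-point x≢y (inj₁ refl) (inj₁ refl) _ = contradiction refl x≢y
two-point x≢y (inj₂ refl) (inj₂ refl) _ = contradiction refl x≢y
two-point _   (inj₁ refl) (inj₂ refl) k = k
two-point _   (inj₂ refl) (inj₁ refl) (inj₁ k≡i) = inj₂ k≡i
two-point _   (inj₂ refl) (inj₁ refl) (inj₂ k≡j) = inj₁ k≡j

module Labels {B : Set} {P : B → Set} (label : ∀ {x} → P x → ℕ) where

  labels : {xs : List B} → All P xs → List ℕ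
  labels []         = []
  labels (px ∷ pxs) = label px ∷ labels pxs

  labels-length : {xs : List B} (pxs : All P xs) → length (labels pxs) ≡ length xs
  labels-length []         = refl
  labels-length (_ ∷ pxs) = cong suc (labels-length pxs)

  labels-all : {Q : ℕ → Set} → (∀ {x} (px : P x) → Q (label px)) →
               {xs : List B} (pxs : All P xs) → All Q (labels pxs)
  labels-all q []         = []
  labels-all q (px ∷ pxs) = q px ∷ labels-all q pxs

  labels-distinct : {R : B → B → Set} → (∀ {x y} → R x y → (px : P x) (py : P y) → label px ≢ label py) →
                    {xs : List B} → AllPairs R xs → (pxs : All P xs) → AllPairs _≢_ (labels pxs)
  labels-distinct separate []         []         = []
  labels-distinct {R} separate (Rx ∷ Rxs) (px ∷ pxs) = apart Rx pxs ∷ labels-distinct separate Rxs pxs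
    where
    apart : ∀ {ys} → All (R _) ys → (pys : All P ys) → All (label px ≢_) (labels pys)
    apart []         []         = []
    apart (r ∷ rs)   (py ∷ pys) = separate r px py ∷ apart rs pys

module Oddities {A : Set} (_≟_ : DecidableEquality A) where
  open Words _≟_

  suffix? : (x v : Word) → Dec (∃[ a ] a ++ x ≡ v)
  suffix? x [] with x ≟w []
  ... | yes x≡[] = yes ([] , x≡[])
  ... | no  x≢[] = no λ { ([] , eq) → x≢[] eq ; (_ ∷ _ , ()) }
  suffix? x (c ∷ v) with x ≟w (c ∷ v) | suffix? x v
  ... | yes x≡cv | _            = yes ([] , x≡cv)
  ... | no  _    | yes (a , eq) = yes (c ∷ a , cong (c ∷_) eq)
  ... | no  x≢cv | no  ¬suffix  = no λ { ([] , eq) → x≢cv eq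
                                       ; (_ ∷ a , eq) → ¬suffix (a , proj₂ (∷-injective eq)) }

  inits-prefix : ∀ {u : Word} (s : Word) → u ∈ inits s → ∃[ r ] u ++ r ≡ s
  inits-prefix []      (here refl) = [] , refl
  inits-prefix (x ∷ s) (here refl) = x ∷ s , refl
  inits-prefix (x ∷ s) (there u∈) with ∈-map⁻ (x ∷_) {xs = inits s} u∈
  ... | u′ , u′∈ , refl with inits-prefix s u′∈
  ...   | r , eq = r , cong (x ∷_) eq

  tails-suffix : ∀ {u : Word} (s : Word) → u ∈ tails s → ∃[ q ] q ++ u ≡ s
  tails-suffix s       (here refl) = [] , refl
  tails-suffix (x ∷ s) (there u∈) with tails-suffix s u∈
  ... | q , eq = x ∷ q , cong (x ∷_) eq

  PAL-sound : ∀ {u : Word} (t : Word) → u ∈ PAL t → IsPal u × FactorF t u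
  PAL-sound t u∈ with ∈-filter⁻ (λ v → reverse v ≟w v) {xs = allFactors t} (∈-deduplicate⁻ _≟w_ _ u∈)
  ... | u∈factors , pal with find (∈-concatMap⁻ inits {xs = tails t} u∈factors)
  ...   | s , s∈tails , u∈inits with tails-suffix t s∈tails | inits-prefix s u∈inits
  ...     | q , qs≡t | r , ur≡s = pal , q , r , trans (cong (q ++_) ur≡s) qs≡t

  PAL-distinct : (t : Word) → AllPairs _≢_ (PAL t)
  PAL-distinct t = deduplicate-! _≟w_ (filter (λ v → reverse v ≟w v) (allFactors t))

  pair : Word → List Word
  pair w = w ∷ reverse w ∷ []

  -- Belonging to a common pair is an equivalence; in Euclidean form:
  -- two members of one pair each belong to the pair of the other.
  pair-link : ∀ {w x y} → x ∈ pair w → y ∈ pair w → x ∈ pair y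
  pair-link           (here refl)         (here refl)         = here refl
  pair-link {w}       (here refl)         (there (here refl)) = there (here (sym (reverse-involutive w)))
  pair-link           (there (here refl)) (here refl)         = there (here refl)
  pair-link           (there (here refl)) (there (here refl)) = here refl
  pair-link           (there (there ()))  _
  pair-link           _                   (there (there ()))

  pair-reverse : ∀ {w x} → x ∈ pair w → reverse x ∈ pair w
  pair-reverse     (here refl)         = there (here refl)
  pair-reverse {w} (there (here refl)) = here (reverse-involutive w)
  pair-reverse     (there (there ()))

  pair-nonPal : ∀ {x y} → x ∈ pair y → ¬ IsPal y → ¬ IsPal x
  pair-nonPal     (here refl)         ¬pal = ¬pal
  pair-nonPal {y = y} (there (here refl)) ¬pal pal = ¬pal (sym (trans (sym (reverse-involutive y)) pal))
  pair-nonPal     (there (there ()))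

  record Return (u X : Word) : Set where
    field
      prefix    : ∃[ s ] u ++ s ≡ X
      suffix    : ∃[ a ] a ++ u ≡ X
      shorter   : length u < length X
      only-ends : ∀ k → OccursAt u X k → k ≡ 0 ⊎ k + length u ≡ length X

  return-of : ∀ {u X} → IsCompleteReturn u X → Return u X
  return-of {u} {X} ((s , us≡X) , (a , au≡X) , (i , j , i≢j , at-i , at-j , only)) = record
    { prefix    = s , us≡X
    ; suffix    = a , au≡X
    ; shorter   = subst (length u <_) end-position (m<n+m (length u) (n≢0⇒n>0 a≢0))
    ; only-ends = λ k at-k → map₂ (λ k≡a → trans (cong (_+ length u) k≡a) end-position)
                               (two-point 0≢a (only 0 at-start) (only (length a) at-end) (only k at-k))
    }
    where
    at-start : OccursAt u X 0
    at-start = [] , s , refl , us≡X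
    at-end : OccursAt u X (length a)
    at-end = a , [] , refl , trans (cong (a ++_) (++-identityʳ u)) au≡X
    end-position : length a + length u ≡ length X
    end-position = trans (sym (length-++ a)) (cong length au≡X)
    before-end : ∀ {k} → OccursAt u X k → k ≤ length a
    before-end (p , r , refl , occ) = +-cancelʳ-≤ (length u) (length p) (length a)
      (≤-trans (occurrence-fits p u r X occ) (≤-reflexive (sym end-position)))
    a≢0 : length a ≢ 0
    a≢0 a≡0 = i≢j (trans (at-zero at-i) (sym (at-zero at-j)))
      where
      at-zero : ∀ {k} → OccursAt u X k → k ≡ 0
      at-zero at-k = n≤0⇒n≡0 (subst (_ ≤_) a≡0 (before-end at-k))
    0≢a : 0 ≢ length a
    0≢a 0≡a = a≢0 (sym 0≡a)

  mirror-occurrence : ∀ {u X} p s → IsPal u → p ++ u ++ s ≡ reverse X → reverse s ++ u ++ reverse p ≡ X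
  mirror-occurrence {u} {X} p s pal occ = begin
      reverse s ++ u ++ reverse p            ≡⟨ cong (λ v → reverse s ++ v ++ reverse p) (sym pal) ⟩
      reverse s ++ reverse u ++ reverse p    ≡⟨ sym (++-assoc (reverse s) (reverse u) (reverse p)) ⟩
      (reverse s ++ reverse u) ++ reverse p  ≡⟨ cong (_++ reverse p) (sym (reverse-++ u s)) ⟩
      reverse (u ++ s) ++ reverse p          ≡⟨ sym (reverse-++ p (u ++ s)) ⟩
      reverse (p ++ u ++ s)                  ≡⟨ cong reverse occ ⟩
      reverse (reverse X)                    ≡⟨ reverse-involutive X ⟩
      X                                      ∎
    where open ≡-Reasoning

  return-reverse : ∀ {u X} → IsPal u → Return u X → Return u (reverse X)
  return-reverse {u} {X} pal R = record
    { prefix    = reverse a , u++ã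
    ; suffix    = reverse s , s̃++u
    ; shorter   = subst (length u <_) (sym (length-reverse X)) shorter
    ; only-ends = mirrored
    }
    where
    open Return R
    open ≡-Reasoning
    s a : Word
    s = proj₁ prefix
    a = proj₁ suffix
    u++ã : u ++ reverse a ≡ reverse X
    u++ã = begin
        u ++ reverse a           ≡⟨ cong (_++ reverse a) (sym pal) ⟩
        reverse u ++ reverse a   ≡⟨ sym (reverse-++ a u) ⟩
        reverse (a ++ u)         ≡⟨ cong reverse (proj₂ suffix) ⟩
        reverse X                ∎
    s̃++u : reverse s ++ u ≡ reverse X
    s̃++u = begin
        reverse s ++ u           ≡⟨ cong (reverse s ++_) (sym pal) ⟩
        reverse s ++ reverse u   ≡⟨ sym (reverse-++ u s) ⟩
        reverse (u ++ s)         ≡⟨ cong reverse (proj₂ prefix) ⟩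
        reverse X                ∎
    mirrored : ∀ k → OccursAt u (reverse X) k → k ≡ 0 ⊎ k + length u ≡ length (reverse X)
    mirrored k (p , r , refl , occ) with only-ends (length r) (reverse r , reverse p , length-reverse r , mirror-occurrence p r pal occ)
    ... | inj₁ r≡0 = inj₂ (trans (cong (length p +_) (sym (trans (cong (length u +_) r≡0) (+-identityʳ (length u)))))
                                (length-occurrence p u r (reverse X) occ))
    ... | inj₂ r-ends = inj₁ (+-cancelʳ-≡ (length u + length r) (length p) 0
                               (trans (length-occurrence p u r (reverse X) occ)
                                 (trans (length-reverse X) (trans (sym r-ends) (+-comm (length r) (length u))))))

  return-pair : ∀ {u x y} → IsPal u → Return u y → x ∈ pair y → Return u x
  return-pair pal R (here refl)         = R
  return-pair pal R (there (here refl)) = return-reverse pal R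
  return-pair pal R (there (there ()))

  -- A palindromic suffix p of a complete return X to a palindrome u, with
  -- |u| ≤ |p| < |X|, is u itself: otherwise u would occur strictly inside X.
  return-pal-suffix : ∀ {u X p} d → IsPal u → Return u X → IsPal p → d ++ p ≡ X →
                      length p < length X → length u ≤ length p → p ≡ u
  return-pal-suffix {u} {X} {p} d palu R palp dp≡X p<X u≤p =
    at-an-end (only-ends (length d) (d , reverse f , refl , u-inside))
    where
    open Return R
    a : Word
    a = proj₁ suffix
    dp≡au : d ++ p ≡ a ++ u
    dp≡au = trans dp≡X (sym (proj₂ suffix))
    u-suffix : ∃[ f ] p ≡ f ++ u
    u-suffix = ++-suffix d p a u dp≡au u≤p
    f : Word
    f = proj₁ u-suffix
    u-prefix : p ≡ u ++ reverse f
    u-prefix = trans (palindrome-suffix p f u palp (proj₂ u-suffix)) (cong (_++ reverse f) palu)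
    u-inside : d ++ u ++ reverse f ≡ X
    u-inside = trans (cong (d ++_) (sym u-prefix)) dp≡X
    dp-length : length d + length p ≡ length X
    dp-length = trans (sym (length-++ d)) (cong length dp≡X)
    at-an-end : length d ≡ 0 ⊎ length d + length u ≡ length X → p ≡ u
    at-an-end (inj₁ d≡0)   = contradiction (trans (cong (_+ length p) (sym d≡0)) dp-length)
                                           (λ p≡X → <-irrefl p≡X p<X)
    at-an-end (inj₂ u-end) = ++-suffix-≡ d p a u dp≡au
                               (+-cancelˡ-≡ (length d) (length p) (length u) (trans dp-length (sym u-end)))

  -- Two complete returns to u which are suffixes of one word coincide: the
  -- longer would contain u at a position other than its two ends.
  return-suffix-shorter : ∀ {u X Y} a b → Return u X → Return u Y → a ++ X ≡ b ++ Y →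
                          length X ≤ length Y → X ≡ Y
  return-suffix-shorter {u} {X} {Y} a b RX RY eq X≤Y =
    at-an-end (Return.only-ends RY (length d) (d , s , refl , u-inside))
    where
    X-suffix : ∃[ d ] Y ≡ d ++ X
    X-suffix = ++-suffix b Y a X (sym eq) X≤Y
    d s : Word
    d = proj₁ X-suffix
    s = proj₁ (Return.prefix RX)
    u-inside : d ++ u ++ s ≡ Y
    u-inside = sym (trans (proj₂ X-suffix) (cong (d ++_) (sym (proj₂ (Return.prefix RX)))))
    dX-length : length d + length X ≡ length Y
    dX-length = trans (sym (length-++ d)) (cong length (sym (proj₂ X-suffix)))
    at-an-end : length d ≡ 0 ⊎ length d + length u ≡ length Y → X ≡ Y
    at-an-end (inj₁ d≡0)   = ++-suffix-≡ a X b Y eq (trans (cong (_+ length X) (sym d≡0)) dX-length)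
    at-an-end (inj₂ u-end) = contradiction
      (+-cancelˡ-≡ (length d) (length u) (length X) (trans u-end (sym dX-length)))
      (λ u≡X → <-irrefl u≡X (Return.shorter RX))

  return-suffix-unique : ∀ {u X Y} a b → Return u X → Return u Y → a ++ X ≡ b ++ Y → X ≡ Y
  return-suffix-unique {X = X} {Y} a b RX RY eq with ≤-total (length X) (length Y)
  ... | inj₁ X≤Y = return-suffix-shorter a b RX RY eq X≤Y
  ... | inj₂ Y≤X = sym (return-suffix-shorter b a RY RX (sym eq) Y≤X)

  representative : ∀ {F w} → OddityRep F w → ∃[ y ] y ∈ pair w × NonPalCR F y
  representative {w = w} (inj₁ r) = w , here refl , r
  representative {w = w} (inj₂ r) = reverse w , there (here refl) , r

  module FirstOccurrences (t : Word) where

    EndsAt : Word → ℕ → Set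
    EndsAt y e = ∃[ a ] a ++ y ≡ take e t

    occurrence-ends : ∀ a y b → a ++ y ++ b ≡ t → EndsAt y (length a + length y)
    occurrence-ends a y b occ = a , sym (prefix-until a y b t occ)

    record FirstEnd (ys : List Word) : Set where
      field
        end     : ℕ
        word    : Word
        member  : word ∈ ys
        before  : Word
        ends    : before ++ word ≡ take end t
        minimal : ∀ {y} a b → y ∈ ys → a ++ y ++ b ≡ t → end ≤ length a + length y
        bounded : end ≤ length t

    firstEnd : ∀ ys {y} a b → y ∈ ys → a ++ y ++ b ≡ t → FirstEnd ys
    firstEnd ys {y} a b y∈ occ
      with least-witness (λ e → any? (λ z → suffix? z (take e t)) ys)
                         (length a + length y) (lose y∈ (occurrence-ends a y b occ))
    ... | e , found , e≤ , isLeast with find found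
    ...   | z , z∈ , c , ends = record
      { end     = e
      ; word    = z
      ; member  = z∈
      ; before  = c
      ; ends    = ends
      ; minimal = λ a′ b′ y′∈ occ′ → isLeast _ (lose y′∈ (occurrence-ends a′ _ b′ occ′))
      ; bounded = ≤-trans e≤ (occurrence-fits a y b t occ)
      }

    no-earlier : ∀ {ys y} (F : FirstEnd ys) c g → y ∈ ys → c ++ y ++ g ≡ take (FirstEnd.end F) t → g ≡ []
    no-earlier F c []      y∈ _  = refl
    no-earlier {y = y} F c (x ∷ g) y∈ cyg≡ = contradiction (minimal c (x ∷ g ++ drop end t) y∈ occ) (<⇒≱ earlier)
      where
      open FirstEnd F
      occ : c ++ y ++ (x ∷ g) ++ drop end t ≡ t
      occ = begin
          c ++ y ++ (x ∷ g) ++ drop end t    ≡⟨ cong (c ++_) (sym (++-assoc y (x ∷ g) (drop end t))) ⟩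
          c ++ (y ++ x ∷ g) ++ drop end t    ≡⟨ sym (++-assoc c (y ++ x ∷ g) (drop end t)) ⟩
          (c ++ y ++ x ∷ g) ++ drop end t    ≡⟨ cong (_++ drop end t) cyg≡ ⟩
          take end t ++ drop end t           ≡⟨ take++drop≡id end t ⟩
          t                                  ∎
        where open ≡-Reasoning
      earlier : length c + length y < end
      earlier = begin-strict
          length c + length y                         <⟨ m<m+n (length c + length y) (s≤s z≤n) ⟩
          length c + length y + length (x ∷ g)        ≡⟨ +-assoc (length c) (length y) (length (x ∷ g)) ⟩
          length c + (length y + length (x ∷ g))      ≡⟨ length-occurrence c y (x ∷ g) (take end t) cyg≡ ⟩
          length (take end t)                         ≡⟨ length-take end t ⟩
          end ⊓ length t                              ≤⟨ m⊓n≤m end (length t) ⟩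
          end                                         ∎
        where open ≤-Reasoning

    PalEnd : Word → Set
    PalEnd p = IsPal p × FirstEnd (p ∷ [])

    palEnd-ends : ∀ {p} (F : FirstEnd (p ∷ [])) → EndsAt p (FirstEnd.end F)
    palEnd-ends record { member = here refl ; before = c ; ends = ends } = c , ends

    -- Palindromes whose first occurrences end at the same place are equal: the
    -- shorter one is a suffix, hence a prefix, of the longer and would occur earlier.
    palEnd-shorter : ∀ {p q} → (P : PalEnd p) (Q : PalEnd q) →
                     FirstEnd.end (proj₂ P) ≡ FirstEnd.end (proj₂ Q) → length p ≤ length q → p ≡ q
    palEnd-shorter {p} {q} (palp , F) (palq , G) same p≤q =
      sym (trans q≡p++f̃ (trans (cong (p ++_) f̃≡[]) (++-identityʳ p)))
      where
      c d : Word
      c = proj₁ (palEnd-ends F)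
      d = proj₁ (palEnd-ends G)
      dq≡cp : d ++ q ≡ c ++ p
      dq≡cp = trans (proj₂ (palEnd-ends G)) (trans (cong (λ e → take e t) (sym same)) (sym (proj₂ (palEnd-ends F))))
      p-suffix : ∃[ f ] q ≡ f ++ p
      p-suffix = ++-suffix d q c p dq≡cp p≤q
      f : Word
      f = proj₁ p-suffix
      q≡p++f̃ : q ≡ p ++ reverse f
      q≡p++f̃ = trans (palindrome-suffix q f p palq (proj₂ p-suffix)) (cong (_++ reverse f) palp)
      f̃≡[] : reverse f ≡ []
      f̃≡[] = no-earlier F d (reverse f) (here refl)
               (trans (cong (d ++_) (sym q≡p++f̃)) (trans dq≡cp (proj₂ (palEnd-ends F))))

    palEnd-injective : ∀ {p q} → (P : PalEnd p) (Q : PalEnd q) →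
                       FirstEnd.end (proj₂ P) ≡ FirstEnd.end (proj₂ Q) → p ≡ q
    palEnd-injective {p} {q} P Q same with ≤-total (length p) (length q)
    ... | inj₁ p≤q = palEnd-shorter P Q same p≤q
    ... | inj₂ q≤p = sym (palEnd-shorter Q P (sym same) q≤p)

    record OddityEnd (w : Word) : Set where
      field
        first      : FirstEnd (pair w)
        centre     : Word
        centre-pal : IsPal centre
      open FirstEnd first public
      field
        return     : Return centre word
        nonPal     : ¬ IsPal word

    oddityEnd : ∀ {w} → OddityRep (FactorF t) w → OddityEnd w
    oddityEnd {w} rep with representative rep
    ... | y , y∈ , (a , b , occ) , ¬pal , u , _ , palu , _ , cr = record
      { first      = F
      ; centre     = u
      ; centre-pal = palu
      ; return     = return-pair palu (return-of cr) word∈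
      ; nonPal     = pair-nonPal word∈ ¬pal
      }
      where
      F : FirstEnd (pair w)
      F = firstEnd (pair w) a b y∈ occ
      word∈ : FirstEnd.word F ∈ pair y
      word∈ = pair-link (FirstEnd.member F) y∈

    module AtOddityEnd {w} (o : OddityEnd w) where
      open OddityEnd o

      rest : Word
      rest = proj₁ (Return.prefix return)

      centre++rest : centre ++ rest ≡ word
      centre++rest = proj₂ (Return.prefix return)

      rest-nonempty : rest ≢ []
      rest-nonempty rest≡[] = <-irrefl (cong length u≡X) (Return.shorter return)
        where
        u≡X : centre ≡ word
        u≡X = trans (sym (++-identityʳ centre)) (trans (cong (centre ++_) (sym rest≡[])) centre++rest)

      centre-ends : EndsAt centre end
      centre-ends = before ++ a , trans (++-assoc before a centre) (trans (cong (before ++_) au≡X) ends)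
        where
        a : Word
        a = proj₁ (Return.suffix return)
        au≡X : a ++ centre ≡ word
        au≡X = proj₂ (Return.suffix return)

      -- A palindromic suffix of the prefix, at least as long as the centre, is the
      -- centre: were it longer than the word, it would contain the reversed word
      -- occurring earlier; otherwise it is a palindromic suffix of the return.
      pal-suffix-centre : ∀ {p} c → c ++ p ≡ take end t → IsPal p → length centre ≤ length p → p ≡ centre
      pal-suffix-centre {p} c cp≡ palp u≤p with length word ≤? length p
      ... | yes X≤p = contradiction (subst IsPal (sym X̃≡p) palp) (pair-nonPal (there (here refl)) nonPal)
        where
        X-suffix : ∃[ f ] p ≡ f ++ word
        X-suffix = ++-suffix c p before word (trans cp≡ (sym ends)) X≤p
        f : Word
        f = proj₁ X-suffix
        p≡X̃f̃ : p ≡ reverse word ++ reverse f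
        p≡X̃f̃ = palindrome-suffix p f word palp (proj₂ X-suffix)
        f̃≡[] : reverse f ≡ []
        f̃≡[] = no-earlier first c (reverse f) (pair-reverse member) (trans (cong (c ++_) (sym p≡X̃f̃)) cp≡)
        X̃≡p : reverse word ≡ p
        X̃≡p = sym (trans p≡X̃f̃ (trans (cong (reverse word ++_) f̃≡[]) (++-identityʳ (reverse word))))
      ... | no X≰p = return-pal-suffix d centre-pal return palp (sym (proj₂ p-suffix)) (≰⇒> X≰p) u≤p
        where
        p-suffix : ∃[ d ] word ≡ d ++ p
        p-suffix = ++-suffix before word c p (trans ends (sym cp≡)) (<⇒≤ (≰⇒> X≰p))
        d : Word
        d = proj₁ p-suffix

      pal-suffix-prefix : ∀ {p} c → c ++ p ≡ take end t → IsPal p → ∃[ g ] word ≡ p ++ g × g ≢ []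
      pal-suffix-prefix {p} c cp≡ palp with length centre ≤? length p
      ... | yes u≤p = rest , trans (sym centre++rest) (cong (_++ rest) (sym (pal-suffix-centre c cp≡ palp u≤p)))
                    , rest-nonempty
      ... | no u≰p = reverse f ++ rest , X≡p++f̃s , λ f̃s≡[] → rest-nonempty (++-conicalʳ (reverse f) rest f̃s≡[])
        where
        p-suffix : ∃[ f ] centre ≡ f ++ p
        p-suffix = ++-suffix (proj₁ centre-ends) centre c p (trans (proj₂ centre-ends) (sym cp≡)) (<⇒≤ (≰⇒> u≰p))
        f : Word
        f = proj₁ p-suffix
        X≡p++f̃s : word ≡ p ++ reverse f ++ rest
        X≡p++f̃s = begin
            word                              ≡⟨ sym centre++rest ⟩
            centre ++ rest                    ≡⟨ cong (_++ rest) (palindrome-suffix centre f p centre-pal (proj₂ p-suffix)) ⟩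
            (reverse p ++ reverse f) ++ rest  ≡⟨ cong (λ v → (v ++ reverse f) ++ rest) palp ⟩
            (p ++ reverse f) ++ rest          ≡⟨ ++-assoc p (reverse f) rest ⟩
            p ++ reverse f ++ rest            ∎
          where open ≡-Reasoning

    open AtOddityEnd

    -- A palindrome and an oddity never have their first occurrences ending at the
    -- same place: the palindrome would be a proper prefix of the oddity's word.
    palEnd≢oddityEnd : ∀ {p w} (P : PalEnd p) (o : OddityEnd w) → FirstEnd.end (proj₂ P) ≢ OddityEnd.end o
    palEnd≢oddityEnd (palp , F) o same with palEnd-ends F
    ... | c , cp≡ with pal-suffix-prefix o c (trans cp≡ (cong (λ e → take e t) same)) palp
    ...   | g , X≡pg , g≢[] = g≢[] (no-earlier F (OddityEnd.before o) g (here refl)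
              (trans (cong (OddityEnd.before o ++_) (sym X≡pg)) (trans (OddityEnd.ends o) (cong (λ e → take e t) (sym same)))))

    -- Oddities whose first occurrences end at the same place are the same pair:
    -- both centres are the longest palindromic suffix there, and two complete
    -- returns to one centre ending at one place coincide.
    oddityEnd-injective : ∀ {w₁ w₂} (o₁ : OddityEnd w₁) (o₂ : OddityEnd w₂) →
                          OddityEnd.end o₁ ≡ OddityEnd.end o₂ → w₁ ∈ pair w₂
    oddityEnd-injective o₁ o₂ same =
      pair-link (pair-link (here refl) O₁.member) (pair-link (here refl) X₁∈pair-w₂)
      where
      module O₁ = OddityEnd o₁
      module O₂ = OddityEnd o₂
      u₂-ends : EndsAt O₂.centre O₁.end
      u₂-ends = subst (EndsAt O₂.centre) (sym same) (centre-ends o₂)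
      u₁-ends : EndsAt O₁.centre O₂.end
      u₁-ends = subst (EndsAt O₁.centre) same (centre-ends o₁)
      centres : O₁.centre ≡ O₂.centre
      centres with ≤-total (length O₁.centre) (length O₂.centre)
      ... | inj₁ u₁≤u₂ = sym (pal-suffix-centre o₁ (proj₁ u₂-ends) (proj₂ u₂-ends) O₂.centre-pal u₁≤u₂)
      ... | inj₂ u₂≤u₁ = pal-suffix-centre o₂ (proj₁ u₁-ends) (proj₂ u₁-ends) O₁.centre-pal u₂≤u₁
      words : O₁.word ≡ O₂.word
      words = return-suffix-unique O₁.before O₂.before (subst (λ u → Return u O₁.word) centres O₁.return) O₂.return
                (trans O₁.ends (trans (cong (λ e → take e t) same) (sym O₂.ends)))
      X₁∈pair-w₂ : O₁.word ∈ pair _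
      X₁∈pair-w₂ = subst (_∈ pair _) (sym words) O₂.member

    -- The count: first-occurrence ends of the distinct palindromes and of the
    -- distinct oddities are pairwise different positions among 0, …, |t|.
    defect-bound : ∀ ws → OddityList (FactorF t) ws → length ws ≤ defect t
    defect-bound ws (reps , distinct) =
      m+n≤o⇒m≤o∸n (length ws) (subst (_≤ suc (length t)) total (distinct-below _ _ ends-distinct ends-bounded))
      where
      palEnds : All PalEnd (PAL t)
      palEnds = All.tabulate (λ p∈ → palEnd (PAL-sound t p∈))
        where
        palEnd : ∀ {p} → IsPal p × FactorF t p → PalEnd p
        palEnd (pal , a , b , occ) = pal , firstEnd _ a b (here refl) occ
      oddEnds : All OddityEnd ws
      oddEnds = All.map oddityEnd reps
      module PL = Labels (λ (P : PalEnd _) → FirstEnd.end (proj₂ P))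
      module OL = Labels OddityEnd.end
      ends : List ℕ
      ends = OL.labels oddEnds ++ PL.labels palEnds
      ends-distinct : AllPairs _≢_ ends
      ends-distinct = AllPairsProp.++⁺
        (OL.labels-distinct (λ { (≢w , ≢w̃) o₁ o₂ same → separate ≢w ≢w̃ (oddityEnd-injective o₁ o₂ same) }) distinct oddEnds)
        (PL.labels-distinct (λ p≢q P Q same → p≢q (palEnd-injective P Q same)) (PAL-distinct t) palEnds)
        (OL.labels-all (λ o → PL.labels-all (λ P same → palEnd≢oddityEnd P o (sym same)) palEnds) oddEnds)
        where
        separate : ∀ {w₁ w₂} → w₁ ≢ w₂ → w₁ ≢ reverse w₂ → ¬ w₁ ∈ pair w₂
        separate ≢w ≢w̃ (here eq)         = ≢w eq
        separate ≢w ≢w̃ (there (here eq)) = ≢w̃ eq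
        separate ≢w ≢w̃ (there (there ()))
      ends-bounded : All (_< suc (length t)) ends
      ends-bounded = AllProp.++⁺ (OL.labels-all (λ o → s≤s (OddityEnd.bounded o)) oddEnds)
                             (PL.labels-all (λ P → s≤s (FirstEnd.bounded (proj₂ P))) palEnds)
      total : length ends ≡ length ws + length (PAL t)
      total = trans (length-++ (OL.labels oddEnds)) (cong₂ _+_ (OL.labels-length oddEnds) (PL.labels-length palEnds))

  module Prefixes (x : ℕ → A) where

    prefix : ℕ → Word
    prefix N = segment x 0 N

    prefix-length : ∀ N → length (prefix N) ≡ N
    prefix-length N = trans (length-map _ (upTo N)) (length-upTo N)

    prefix-factor : ∀ N → FactorI x (prefix N)
    prefix-factor N = 0 , cong (segment x 0) (sym (prefix-length N))

    segment-in-prefix : ∀ i n N → i + n ≤ N → FactorF (prefix N) (segment x i n)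
    segment-in-prefix i n N i+n≤N = applyUpTo x i , applyUpTo (λ k → x (i + (n + k))) r , cut
      where
      open ≡-Reasoning
      r : ℕ
      r = N ∸ (i + n)
      cut : applyUpTo x i ++ segment x i n ++ applyUpTo (λ k → x (i + (n + k))) r ≡ prefix N
      cut = begin
          applyUpTo x i ++ segment x i n ++ applyUpTo (λ k → x (i + (n + k))) r
            ≡⟨ cong (λ v → applyUpTo x i ++ v ++ applyUpTo (λ k → x (i + (n + k))) r) (map-upTo (λ k → x (i + k)) n) ⟩
          applyUpTo x i ++ applyUpTo (λ k → x (i + k)) n ++ applyUpTo (λ k → x (i + (n + k))) r
            ≡⟨ cong (applyUpTo x i ++_) (sym (applyUpTo-++ (λ k → x (i + k)) n r)) ⟩
          applyUpTo x i ++ applyUpTo (λ k → x (i + k)) (n + r)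
            ≡⟨ sym (applyUpTo-++ x i (n + r)) ⟩
          applyUpTo x (i + (n + r))
            ≡⟨ cong (applyUpTo x) (trans (sym (+-assoc i n r)) (m+[n∸m]≡n i+n≤N)) ⟩
          applyUpTo x N
            ≡⟨ sym (map-upTo x N) ⟩
          prefix N ∎

    factor-in-prefix : ∀ {v} N → (occ : FactorI x v) → proj₁ occ + length v ≤ N → FactorF (prefix N) v
    factor-in-prefix {v} N (i , v≡) fits = subst (FactorF (prefix N)) (sym v≡) (segment-in-prefix i (length v) N fits)

    reach : ∀ {w} → NonPalCR (FactorI x) w → ℕ
    reach {w} ((i , _) , _ , u , _ , _ , (j , _) , _) = (i + length w) + (j + length u)

    nonPalCR-in-prefix : ∀ {w} N → (r : NonPalCR (FactorI x) w) → reach r ≤ N → NonPalCR (FactorF (prefix N)) w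
    nonPalCR-in-prefix {w} N (w-occ , ¬pal , u , u≢[] , palu , u-occ , cr) fits =
      factor-in-prefix N w-occ (m+n≤o⇒m≤o _ fits) , ¬pal , u , u≢[] , palu ,
      factor-in-prefix N u-occ (m+n≤o⇒n≤o (proj₁ w-occ + length w) fits) , cr

    oddityReach : ∀ {w} → OddityRep (FactorI x) w → ℕ
    oddityReach (inj₁ r) = reach r
    oddityReach (inj₂ r) = reach r

    oddity-in-prefix : ∀ {w} N → (r : OddityRep (FactorI x) w) → oddityReach r ≤ N → OddityRep (FactorF (prefix N)) w
    oddity-in-prefix N (inj₁ r) fits = inj₁ (nonPalCR-in-prefix N r fits)
    oddity-in-prefix N (inj₂ r) fits = inj₂ (nonPalCR-in-prefix N r fits)

    totalReach : ∀ {ws} → All (OddityRep (FactorI x)) ws → ℕ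
    totalReach []         = 0
    totalReach (r ∷ reps) = oddityReach r + totalReach reps

    oddities-in-prefix : ∀ {ws} N → (reps : All (OddityRep (FactorI x)) ws) → totalReach reps ≤ N →
                         All (OddityRep (FactorF (prefix N))) ws
    oddities-in-prefix N []         _    = []
    oddities-in-prefix N (r ∷ reps) fits =
      oddity-in-prefix N r (m+n≤o⇒m≤o _ fits) ∷ oddities-in-prefix N reps (m+n≤o⇒n≤o (oddityReach r) fits)

    defect-bound : ∀ ws → OddityList (FactorI x) ws → ∃[ u ] FactorI x u × length ws ≤ defect u
    defect-bound ws (reps , distinct) =
      prefix N , prefix-factor N ,
      FirstOccurrences.defect-bound (prefix N) ws (oddities-in-prefix N reps ≤-refl , distinct)
      where
      N : ℕ
      N = totalReach reps

proposition4p6 : {A : Set} (_≟_ : DecidableEquality A) →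
    let open Words _≟_ in
    (∀ (t : List A) (ws : List (List A)) → OddityList (FactorF t) ws →
        length ws ≤ defect t)
    ×
    (∀ (x : ℕ → A) (ws : List (List A)) → OddityList (FactorI x) ws →
        ∃[ u ] FactorI x u × length ws ≤ defect u)
proposition4p6 _≟_ = (λ t → FirstOccurrences.defect-bound t) , (λ x → Prefixes.defect-bound x)
  where open Oddities _≟_
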